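{- Let $K$ be a set and $\cdot:K\times K\to\mathcal{P}(K)$ a map (extended to subsets by $X\cdot Y=\bigcup_{x\in X,y\in Y}x\cdot y$, with $x\cdot Y=\{x\}\cdot Y$ and $X\cdot y=X\cdot\{y\}$), together with $N\subseteq K$, such that $(K,\cdot,N)$ is a frame satisfying (h) $x\cdot y\subseteq x\cdot(x\cdot y)$ and (p) $(x\cdot y)\cdot z\subseteq x\cdot(y\cdot z)$ for all $x,y,z\in K$. If $g,a_1,b_1,\dots,a_n,b_n\in K$ satisfy $a_1\in g\cdot b_1$ and $a_{i}\in a_{i-1}\cdot b_i$ for $2\le i\le n$, then there are $a_1',\dots,a_n'\in K$ with $a_1'\in g\cdot b_1$, $a_i'\in a_{i-1}'\cdot b_i$ for $2\le i\le n$, and $a_i\in g\cdot a_i'$ for all $1\le i\le n$.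
   Context: A frame is $(K,\cdot,N)$ with $\cdot:K\times K\to\mathcal{P}(K)$ and $N\subseteq K$ such that, writing $x\le y$ iff $y\in n\cdot x$ for some $n\in N$: $\le$ is reflexive and transitive; if $n\in N$ and $n\le m$ then $m\in N$; and if $z\in x\cdot y$, $x'\le x$, $y'\le y$, $z\le z'$, then $z'\in x'\cdot y'$. -}

module Defs where

open import Level using (Level; _⊔_)
open import Data.Product using (Σ; ∃; _×_; _,_)
open import Data.Fin using (Fin; zero; suc)
open import Data.Nat using (ℕ; zero; suc)
open import Data.Unit.Polymorphic using (⊤)

-- A ternary "hyperoperation" x · y ⊆ K is encoded by its membership
-- predicate: Mem z x y  means  z ∈ x · y.
record Frame (c ℓ : Level) : Set (Level.suc (c ⊔ ℓ)) where
  field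
    K   : Set c
    Mem : K → K → K → Set ℓ
    N   : K → Set ℓ

  _≤_ : K → K → Set (c ⊔ ℓ)
  x ≤ y = Σ K λ n → N n × Mem y n x

  field
    ≤-refl  : ∀ x → x ≤ x
    ≤-trans : ∀ {x y z} → x ≤ y → y ≤ z → x ≤ z
    N-up    : ∀ {n m} → N n → n ≤ m → N m
    compat  : ∀ {x y z x′ y′ z′} → Mem z x y → x′ ≤ x → y′ ≤ y → z ≤ z′ → Mem z′ x′ y′

module _ {c ℓ} (F : Frame c ℓ) where
  open Frame F

  InLeftAssoc : K → K → K → K → Set (c ⊔ ℓ)
  InLeftAssoc w x y z = Σ K λ u → Mem u x y × Mem w u z

  InRightAssoc : K → K → K → K → Set (c ⊔ ℓ)
  InRightAssoc w x y z = Σ K λ v → Mem v y z × Mem w x v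

  PropH : Set (c ⊔ ℓ)
  PropH = ∀ x y z → Mem z x y → InRightAssoc z x x y

  PropP : Set (c ⊔ ℓ)
  PropP = ∀ x y z w → InLeftAssoc w x y z → InRightAssoc w x y z

  -- chain condition (0-based, length n):
  --   a 0 ∈ g · b 0   and   a (i+1) ∈ a i · b (i+1)
  Chain : ∀ {n} → K → (Fin n → K) → (Fin n → K) → Set ℓ
  Chain {zero}  g a b = ⊤ {ℓ}
  Chain {suc n} g a b = Mem (a zero) g (b zero) × Chain (a zero) (λ i → a (suc i)) (λ i → b (suc i))

{-# OPTIONS --safe #-}
module Submission where

open import Defs
open import Level using (_⊔_)
open import Data.Nat using (ℕ; zero; suc)
open import Data.Fin using (Fin; zero; suc)
open import Data.Product using (Σ; _×_; _,_)
open import Data.Unit.Polymorphic using (tt)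
open import Data.Vec.Functional using (Vector; []; _∷_; head; tail)

-- Walk along the chain keeping a′ᵢ with aᵢ ∈ g · a′ᵢ.  At the
-- first step (h) turns a₁ ∈ g · b₁ into a₁ ∈ g · (g · b₁); afterwards
-- aᵢ₊₁ ∈ aᵢ · bᵢ₊₁ ⊆ (g · a′ᵢ) · bᵢ₊₁ ⊆ g · (a′ᵢ · bᵢ₊₁) by (p), which yields
-- a′ᵢ₊₁ ∈ a′ᵢ · bᵢ₊₁ with aᵢ₊₁ ∈ g · a′ᵢ₊₁.

module _ {c ℓ} (F : Frame c ℓ) where
  open Frame F

  LiftedChain : ∀ {n} → K → K → Vector K n → Vector K n → Set (c ⊔ ℓ)
  LiftedChain g h a b =
    Σ (Vector K _) λ a′ → Chain F h a′ b × (∀ i → Mem (a i) g (a′ i))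

  liftedChain-∷ : ∀ {n g h v} {a b : Vector K (suc n)} →
    Mem v h (head b) → Mem (head a) g v →
    LiftedChain g v (tail a) (tail b) → LiftedChain g h a b
  liftedChain-∷ {v = v} v∈hb a∈gv (a′ , chain′ , a∈ga′) =
    v ∷ a′ , (v∈hb , chain′) , λ { zero → a∈gv ; (suc i) → a∈ga′ i }

  absorb : PropH F → ∀ {g b a} → Mem a g b →
    Σ K λ v → Mem v g b × Mem a g v
  absorb H a∈gb = H _ _ _ a∈gb

  reassociate : PropP F → ∀ {g h p b a} → Mem p g h → Mem a p b →
    Σ K λ v → Mem v h b × Mem a g v
  reassociate P p∈gh a∈pb = P _ _ _ _ (_ , p∈gh , a∈pb)

  lift-chain : PropP F → ∀ {n g h p} {a b : Vector K n} →
    Mem p g h → Chain F p a b → LiftedChain g h a b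
  lift-chain P {zero} _ _ = [] , tt , λ ()
  lift-chain P {suc _} {a = a} {b} p∈gh (a₀∈pb₀ , chain)
    with reassociate P p∈gh a₀∈pb₀
  ... | v , v∈hb₀ , a₀∈gv =
    liftedChain-∷ {a = a} {b} v∈hb₀ a₀∈gv (lift-chain P a₀∈gv chain)

lemma3p1 : ∀ {c ℓ} (F : Frame c ℓ) → PropH F → PropP F →
    (n : ℕ) (g : Frame.K F) (a b : Fin n → Frame.K F) →
    Chain F g a b →
    Σ (Fin n → Frame.K F) λ a′ →
    Chain F g a′ b × (∀ i → Frame.Mem F (a i) g (a′ i))
lemma3p1 F H P zero g a b _ = [] , tt , λ ()
lemma3p1 F H P (suc _) g a b (a₀∈gb₀ , chain) with absorb F H a₀∈gb₀
... | v , v∈gb₀ , a₀∈gv =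
  liftedChain-∷ F {a = a} {b} v∈gb₀ a₀∈gv (lift-chain F P a₀∈gv chain)
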